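{- Let $a,h,d,b$ be positive integers with $b\ge3$ and $\gcd(a,d)=1$, and let $A(a)=(a,ha+d,ha+bd,ha+(2b-1)d)$. Suppose $h\ge\left\lceil\frac{d}{b-2}\right\rceil$ and $a\ge 2b^2-5b+2$. Writing $Q=\left\lfloor\frac{a}{2b-1}\right\rfloor$, we have $$g(A(a))=\begin{cases}(Q+b-2)ha+(2b-1)dQ-a-d & \text{if } a\equiv 0,1,\dots,b-2\pmod{2b-1},\\ (Q+b-2)ha+(2b-1)dQ-a+(b-2)d & \text{if } a\equiv b-1\pmod{2b-1},\\ (Q+b-1)ha+(2b-1)dQ-a+(b-1)d & \text{if } a\equiv b,\dots,2b-2\pmod{2b-1}.\end{cases}$$
   Context: For positive integers $a_1,\dots,a_n$ with $\gcd=1$, the Frobenius number $g(a_1,\dots,a_n)$ is the largest integer not representable as $\sum x_ia_i$ with nonnegative integers $x_i$. -}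

module Defs where

open import Data.Nat using (ℕ; zero; suc; _+_; _*_; _∸_; _/_; _%_; NonZero)
open import Data.Integer as ℤ using (ℤ; +_)
open import Data.List using (List; []; _∷_)
open import Data.Product using (Σ; ∃; _×_; _,_)
open import Relation.Binary.PropositionalEquality using (_≡_)
open import Relation.Nullary using (¬_)

-- Linear combination of a list of generators with a list of coefficients
-- (coefficients beyond the length of either list are ignored; we require equal length below).
lincomb : List ℕ → List ℕ → ℕ
lincomb []       _        = 0
lincomb (_ ∷ _)  []       = 0
lincomb (a ∷ as) (x ∷ xs) = x * a + lincomb as xs

data SameLength : List ℕ → List ℕ → Set where
  []  : SameLength [] []
  _∷_ : ∀ {a x as xs} → SameLength as xs → SameLength (a ∷ as) (x ∷ xs)

Representable : List ℕ → ℤ → Set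
Representable as n = Σ (List ℕ) λ xs → SameLength as xs × (n ≡ + lincomb as xs)

IsFrobeniusNumber : List ℕ → ℤ → Set
IsFrobeniusNumber as g = ¬ Representable as g × (∀ n → g ℤ.< n → Representable as n)

-- Total versions of floor division, remainder, ceiling division
-- (value for divisor 0 is irrelevant: only used with nonzero divisors).
div : ℕ → ℕ → ℕ
div m zero    = 0
div m (suc n) = m / suc n

mod : ℕ → ℕ → ℕ
mod m zero    = m
mod m (suc n) = m % suc n

ceilDiv : ℕ → ℕ → ℕ
ceilDiv m zero    = 0
ceilDiv m (suc n) = (m + n) / suc n

-- A combination of the three large generators with multiplicities x₁, x₂, x₃ equals s h a + t d, where
-- s = x₁ + x₂ + x₃ is its size and t = x₁ + b x₂ + M x₃ its weight (M = 2b − 1). Since gcd(a, d) = 1,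
-- its residue modulo a is determined by t mod a, so the Frobenius number is E − a, where E = S h a + T d
-- is the largest minimal element of a residue class. In each of the three cases an explicit pair (S, T)
-- with T < a is given such that
--  * every weight t < a is reached with cost s h a + t d ≤ E: write t = ρ + qM and take x₃ = q, using x₁
--    and at most one x₂ for the digit ρ; where this overshoots T in the incomplete top row q = Q, the
--    hypothesis (b − 2) d ≤ h a lets one trade the excess weight for one unit of size.
--    Hence every k > E − a is representable;
--  * every combination of weight T, or of weight at least T + a, has size at least S, whence E − a is not.
module Submission where

open import Defs
open import Data.Nat using (ℕ; zero; suc; _≤_; _<_; _≤?_; _*_; _+_; _∸_; _/_; _%_; NonZero; z≤n; s≤s)
open import Data.Nat.Properties
open import Data.Nat.DivMod
open import Data.Nat.Divisibility using (_∣_; ∣m+n∣m⇒∣n; n∣m*n; ∣⇒≤)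
open import Data.Nat.Coprimality using (Coprime; coprime-divisor; coprime-Bézout; gcd≡1⇒coprime)
open import Data.Nat.GCD using (gcd; module Bézout)
open import Data.Nat.Tactic.RingSolver using (solve-∀)
open import Data.Integer as ℤ using (+_)
import Data.Integer.Properties as ℤP
import Data.Integer.Tactic.RingSolver as ℤ-Solver
open import Data.List using (List; []; _∷_)
open import Data.Product using (_×_; _,_; ∃)
open import Data.Sum using (_⊎_; inj₁; inj₂)
open import Data.Empty using (⊥-elim)
open import Relation.Nullary using (¬_; Dec; yes; no; contradiction)
open import Relation.Binary.Definitions using (Tri; tri<; tri≈; tri>)
open import Relation.Binary.PropositionalEquality

frobenius-criterion : ∀ A g → (∀ xs → SameLength A xs → lincomb A xs ≢ g) →
                      (∀ k → g < k → Representable A (+ k)) → IsFrobeniusNumber A (+ g)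
frobenius-criterion A g never above = not-g , above-g
  where
  not-g : ¬ Representable A (+ g)
  not-g (xs , len , g≡) = never xs len (sym (ℤP.+-injective g≡))
  above-g : ∀ n → + g ℤ.< n → Representable A n
  above-g (+ k) (ℤ.+<+ g<k) = above k g<k

+p-a-d≡+g : ∀ g a d p → g + a + d ≡ p → + p ℤ.- + a ℤ.- + d ≡ + g
+p-a-d≡+g g a d p refl rewrite ℤP.pos-+ (g + a) d | ℤP.pos-+ g a = cancel (+ g) (+ a) (+ d)
  where
  cancel : ∀ x y z → x ℤ.+ y ℤ.+ z ℤ.- y ℤ.- z ≡ x
  cancel = ℤ-Solver.solve-∀

+p-a+x≡+g : ∀ g a p x → g + a ≡ p + x → + p ℤ.- + a ℤ.+ + x ≡ + g
+p-a+x≡+g g a p x eq = begin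
  + p ℤ.- + a ℤ.+ + x   ≡⟨ swap (+ p) (+ a) (+ x) ⟩
  (+ p ℤ.+ + x) ℤ.- + a ≡⟨ cong (ℤ._- + a) (sym (ℤP.pos-+ p x)) ⟩
  + (p + x) ℤ.- + a     ≡⟨ cong (λ n → + n ℤ.- + a) (sym eq) ⟩
  + (g + a) ℤ.- + a     ≡⟨ cong (ℤ._- + a) (ℤP.pos-+ g a) ⟩
  (+ g ℤ.+ + a) ℤ.- + a ≡⟨ cancel (+ g) (+ a) ⟩
  + g                   ∎
  where
  open ≡-Reasoning
  swap : ∀ p y x → p ℤ.- y ℤ.+ x ≡ (p ℤ.+ x) ℤ.- y
  swap = ℤ-Solver.solve-∀
  cancel : ∀ x y → x ℤ.+ y ℤ.- y ≡ x
  cancel = ℤ-Solver.solve-∀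

coprime-∣-lincomb : ∀ {a d} → Coprime a d → ∀ y z k → y * a + k * d ≡ z * a → a ∣ k
coprime-∣-lincomb {a} {d} cop y z k eq = coprime-divisor cop (subst (a ∣_) (*-comm k d)
  (∣m+n∣m⇒∣n (subst (a ∣_) (sym eq) (n∣m*n z)) (n∣m*n y)))

coprime-lincomb-≡⊎≥ : ∀ {a d} → Coprime a d → ∀ y z t t₀ → t₀ < a →
                      y * a + t * d ≡ z * a + t₀ * d → t ≡ t₀ ⊎ t₀ + a ≤ t
coprime-lincomb-≡⊎≥ {a} {d} cop y z t t₀ t₀<a eq with ≤-<-connex t₀ t
... | inj₁ t₀≤t with m≤n⇒∃[o]m+o≡n t₀≤t
...   | k , refl with coprime-∣-lincomb cop y z k (+-cancelʳ-≡ (t₀ * d) _ _ (trans (shift y a k d t₀) eq))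
  where
  shift : ∀ y a k d t₀ → y * a + k * d + t₀ * d ≡ y * a + (t₀ + k) * d
  shift = solve-∀
...     | a∣k with k
...       | zero = inj₁ (+-identityʳ t₀)
...       | suc _ = inj₂ (+-monoʳ-≤ t₀ (∣⇒≤ a∣k))
coprime-lincomb-≡⊎≥ {a} {d} cop y z t t₀ t₀<a eq | inj₂ t<t₀ with m≤n⇒∃[o]m+o≡n t<t₀
... | k , refl = ⊥-elim (<-irrefl refl (begin-strict
  suc t + k <⟨ t₀<a ⟩
  a         ≤⟨ ∣⇒≤ a∣1+k ⟩
  suc k     ≤⟨ s≤s (m≤n+m k t) ⟩
  suc t + k ∎))
  where
  open ≤-Reasoning
  shift : ∀ z a k d t → z * a + (suc t + k) * d ≡ z * a + (1 + k) * d + t * d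
  shift = solve-∀
  a∣1+k : a ∣ suc k
  a∣1+k = coprime-∣-lincomb cop z y (suc k) (sym (+-cancelʳ-≡ (t * d) _ _ (trans eq (shift z a k d t))))

inverse-mod : ∀ n d → Coprime (suc n) d → ∃ λ y → y * d % suc n ≡ 1 % suc n
inverse-mod n d cop with coprime-Bézout cop
... | Bézout.-+ x y eq = y , trans (cong (_% suc n) (sym eq)) ([m+kn]%n≡m%n 1 x (suc n))
... | Bézout.+- x y eq = n * y , (begin
  n * y * d % suc n                     ≡⟨ sym ([m+kn]%n≡m%n (n * y * d) 1 (suc n)) ⟩
  (n * y * d + 1 * suc n) % suc n       ≡⟨ cong (_% suc n) (trans (expand n y d) (cong (λ z → 1 + n * z) eq)) ⟩
  (1 + n * (x * suc n)) % suc n         ≡⟨ cong (λ z → (1 + z) % suc n) (sym (*-assoc n x (suc n))) ⟩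
  (1 + n * x * suc n) % suc n           ≡⟨ [m+kn]%n≡m%n 1 (n * x) (suc n) ⟩
  1 % suc n                             ∎)
  where
  open ≡-Reasoning
  -- (a − 1)·y·d ≡ −y·d ≡ 1 (mod a) since 1 + y d = x a.
  expand : ∀ n y d → n * y * d + 1 * suc n ≡ 1 + n * (1 + y * d)
  expand = solve-∀

solvable-mod : ∀ n d → Coprime (suc n) d → ∀ k → ∃ λ t → t < suc n × t * d % suc n ≡ k % suc n
solvable-mod n d cop k with inverse-mod n d cop
... | y , yd≡1 = k * y % a , m%n<n (k * y) a , (begin
  k * y % a * d % a               ≡⟨ %-distribˡ-* (k * y % a) d a ⟩
  (k * y % a % a) * (d % a) % a   ≡⟨ cong (λ z → z * (d % a) % a) (m%n%n≡m%n (k * y) a) ⟩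
  (k * y % a) * (d % a) % a       ≡⟨ sym (%-distribˡ-* (k * y) d a) ⟩
  k * y * d % a                   ≡⟨ cong (_% a) (*-assoc k y d) ⟩
  k * (y * d) % a                 ≡⟨ %-distribˡ-* k (y * d) a ⟩
  (k % a) * (y * d % a) % a       ≡⟨ cong (λ z → (k % a) * z % a) yd≡1 ⟩
  (k % a) * (1 % a) % a           ≡⟨ sym (%-distribˡ-* k 1 a) ⟩
  k * 1 % a                       ≡⟨ cong (_% a) (*-identityʳ k) ⟩
  k % a                           ∎)
  where
  open ≡-Reasoning
  a = suc n

m%a≡n%a⇒n≡j*a+m : ∀ m n a .{{_ : NonZero a}} → m % a ≡ n % a → m < n + a → ∃ λ j → n ≡ j * a + m
m%a≡n%a⇒n≡j*a+m m n a m≡n m<n+a with m≤n⇒∃[o]m+o≡n (m/a≤n/a)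
  where
  ρ = n % a
  m≡ : m ≡ ρ + m / a * a
  m≡ = trans (m≡m%n+[m/n]*n m a) (cong (_+ m / a * a) m≡n)
  n+a≡ : n + a ≡ ρ + suc (n / a) * a
  n+a≡ = trans (cong (_+ a) (m≡m%n+[m/n]*n n a)) (shift ρ (n / a) a)
    where
    shift : ∀ ρ q a → ρ + q * a + a ≡ ρ + (1 + q) * a
    shift = solve-∀
  m/a≤n/a : m / a ≤ n / a
  m/a≤n/a = ≤-pred (*-cancelʳ-< a (m / a) (suc (n / a))
              (+-cancelˡ-< ρ _ _ (subst₂ _<_ m≡ n+a≡ m<n+a)))
... | j , m/a+j≡n/a = j , (begin
  n                           ≡⟨ m≡m%n+[m/n]*n n a ⟩
  n % a + n / a * a           ≡⟨ cong (λ q → n % a + q * a) (sym m/a+j≡n/a) ⟩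
  n % a + (m / a + j) * a     ≡⟨ regroup (n % a) (m / a) j a ⟩
  j * a + (n % a + m / a * a) ≡⟨ cong (λ r → j * a + (r + m / a * a)) (sym m≡n) ⟩
  j * a + (m % a + m / a * a) ≡⟨ cong (λ x → j * a + x) (sym (m≡m%n+[m/n]*n m a)) ⟩
  j * a + m                   ∎)
  where
  open ≡-Reasoning
  regroup : ∀ ρ q j a → ρ + (q + j) * a ≡ j * a + (ρ + q * a)
  regroup = solve-∀

-- b = 3 + c and M = 2b − 1 = 5 + 2c, so that no truncated subtraction occurs.
module FourGenerators (n h d c : ℕ) (cop : Coprime (suc n) d) (h≥1 : 1 ≤ h) where
  a b M : ℕ
  a = suc n
  b = 3 + c
  M = 5 + 2 * c

  A : List ℕ
  A = a ∷ (h * a + d) ∷ (h * a + b * d) ∷ (h * a + M * d) ∷ []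

  weight size : ℕ → ℕ → ℕ → ℕ
  weight x₁ x₂ x₃ = x₁ + b * x₂ + M * x₃
  size x₁ x₂ x₃ = x₁ + x₂ + x₃

  cost : ℕ → ℕ → ℕ
  cost s t = s * h * a + t * d

  lincomb-A : ∀ x₀ x₁ x₂ x₃ →
              lincomb A (x₀ ∷ x₁ ∷ x₂ ∷ x₃ ∷ []) ≡ x₀ * a + cost (size x₁ x₂ x₃) (weight x₁ x₂ x₃)
  lincomb-A x₀ x₁ x₂ x₃ = expand x₀ x₁ x₂ x₃ h a d c
    where
    expand : ∀ x₀ x₁ x₂ x₃ h a d c →
             x₀ * a + (x₁ * (h * a + d) + (x₂ * (h * a + (3 + c) * d) + (x₃ * (h * a + (5 + 2 * c) * d) + 0)))
             ≡ x₀ * a + ((x₁ + x₂ + x₃) * h * a + (x₁ + (3 + c) * x₂ + (5 + 2 * c) * x₃) * d)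
    expand = solve-∀

  cost-mono : ∀ {s S t T} → s ≤ S → t ≤ T → cost s t ≤ cost S T
  cost-mono s≤S t≤T = +-mono-≤ (*-monoˡ-≤ a (*-monoˡ-≤ h s≤S)) (*-monoˡ-≤ d t≤T)

  a≤cost : ∀ S T → 1 ≤ S → a ≤ cost S T
  a≤cost S T 1≤S = ≤-trans (subst (_≤ S * h * a) (*-identityˡ a) (*-monoˡ-≤ a (*-mono-≤ 1≤S h≥1)))
                              (m≤m+n (S * h * a) (T * d))

  SizeLowerBound : ℕ → ℕ → Set
  SizeLowerBound S T = ∀ x₁ x₂ x₃ → weight x₁ x₂ x₃ ≡ T ⊎ T + a ≤ weight x₁ x₂ x₃ → S ≤ size x₁ x₂ x₃

  -- With u = x₂ + 2x₃ one has weight = size + (b − 1)u and 2·weight ≥ M u.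
  size-lower-bound : ∀ S T U → T ≡ S + (2 + c) * U → 2 * T < M * suc U → M * S < T + a + M →
                     SizeLowerBound S T
  size-lower-bound S T U T≡ 2T< MS< x₁ x₂ x₃ (inj₁ refl) =
    +-cancelʳ-≤ ((2 + c) * u) S (size x₁ x₂ x₃) (begin
    S + (2 + c) * u             ≤⟨ +-monoʳ-≤ S (*-monoʳ-≤ (2 + c) u≤U) ⟩
    S + (2 + c) * U             ≡⟨ sym T≡ ⟩
    weight x₁ x₂ x₃             ≡⟨ split-weight x₁ x₂ x₃ c ⟩
    size x₁ x₂ x₃ + (2 + c) * u ∎)
    where
    open ≤-Reasoning
    u = x₂ + 2 * x₃
    split-weight : ∀ x₁ x₂ x₃ c → x₁ + (3 + c) * x₂ + (5 + 2 * c) * x₃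
                                  ≡ (x₁ + x₂ + x₃) + (2 + c) * (x₂ + 2 * x₃)
    split-weight = solve-∀
    double-weight : ∀ x₁ x₂ x₃ c → 2 * (x₁ + (3 + c) * x₂ + (5 + 2 * c) * x₃)
                                   ≡ (5 + 2 * c) * (x₂ + 2 * x₃) + (2 * x₁ + x₂)
    double-weight = solve-∀
    u≤U : u ≤ U
    u≤U = ≤-pred (*-cancelˡ-< M u (suc U) (≤-<-trans (subst (M * u ≤_) (sym (double-weight x₁ x₂ x₃ c))
                                                        (m≤m+n (M * u) _)) 2T<))
  size-lower-bound S T U T≡ 2T< MS< x₁ x₂ x₃ (inj₂ T+a≤w) =
    ≤-pred (*-cancelˡ-< M S (suc (size x₁ x₂ x₃)) (begin-strict
    M * S                                                   <⟨ MS< ⟩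
    T + a + M                                               ≤⟨ +-monoˡ-≤ M T+a≤w ⟩
    weight x₁ x₂ x₃ + M                                     ≤⟨ +-monoˡ-≤ M (m≤m+n (weight x₁ x₂ x₃) _) ⟩
    weight x₁ x₂ x₃ + ((4 + 2 * c) * x₁ + (2 + c) * x₂) + M ≡⟨ fill x₁ x₂ x₃ c ⟩
    M * suc (size x₁ x₂ x₃)                                 ∎))
    where
    open ≤-Reasoning
    fill : ∀ x₁ x₂ x₃ c → x₁ + (3 + c) * x₂ + (5 + 2 * c) * x₃ + ((4 + 2 * c) * x₁ + (2 + c) * x₂) + (5 + 2 * c)
                          ≡ (5 + 2 * c) * suc (x₁ + x₂ + x₃)
    fill = solve-∀

  not-representable : ∀ S T → T < a → SizeLowerBound S T →
                      ∀ xs → SameLength A xs → lincomb A xs + a ≢ cost S T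
  not-representable S T T<a bound (x₀ ∷ x₁ ∷ x₂ ∷ x₃ ∷ []) (_∷_ (_∷_ (_∷_ (_∷_ [])))) eq =
    <-irrefl refl (begin-strict
      cost S T                               ≤⟨ cost-mono (bound x₁ x₂ x₃ t≡T⊎) (T≤t t≡T⊎) ⟩
      cost s t                               ≤⟨ m≤n+m (cost s t) (x₀ * a) ⟩
      x₀ * a + cost s t                      <⟨ m<m+n (x₀ * a + cost s t) (s≤s z≤n) ⟩
      x₀ * a + cost s t + a                  ≡⟨ cong (_+ a) (sym (lincomb-A x₀ x₁ x₂ x₃)) ⟩
      lincomb A (x₀ ∷ x₁ ∷ x₂ ∷ x₃ ∷ []) + a ≡⟨ eq ⟩
      cost S T                               ∎)
    where
    open ≤-Reasoning
    s = size x₁ x₂ x₃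
    t = weight x₁ x₂ x₃
    regroup : ∀ x₀ s h a t d → (suc x₀ + s * h) * a + t * d ≡ x₀ * a + (s * h * a + t * d) + a
    regroup = solve-∀
    t≡T⊎ : t ≡ T ⊎ T + a ≤ t
    t≡T⊎ = coprime-lincomb-≡⊎≥ cop (suc x₀ + s * h) (S * h) t T T<a
             (trans (regroup x₀ s h a t d) (trans (cong (_+ a) (sym (lincomb-A x₀ x₁ x₂ x₃))) eq))
    T≤t : t ≡ T ⊎ T + a ≤ t → T ≤ t
    T≤t (inj₁ refl) = ≤-refl
    T≤t (inj₂ T+a≤t) = ≤-trans (m≤m+n T a) T+a≤t

  Reaches : ℕ → ℕ → ℕ → Set
  Reaches S T t = ∃ λ x₁ → ∃ λ x₂ → ∃ λ x₃ → weight x₁ x₂ x₃ ≡ t × cost (size x₁ x₂ x₃) t ≤ cost S T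

  representable-above : ∀ S T → (∀ t → t < a → Reaches S T t) →
                        ∀ k → cost S T < k + a → Representable A (+ k)
  representable-above S T reaches k cost<k+a with solvable-mod n d cop k
  ... | t , t<a , td≡k with reaches t t<a
  ...   | x₁ , x₂ , x₃ , refl , cost≤ with m%a≡n%a⇒n≡j*a+m (cost s t) k a cost≡k (≤-<-trans cost≤ cost<k+a)
    where
    s = size x₁ x₂ x₃
    cost≡k : cost s t % a ≡ k % a
    cost≡k = trans (%-remove-+ˡ (t * d) (n∣m*n (s * h))) td≡k
  ...     | j , k≡ = (j ∷ x₁ ∷ x₂ ∷ x₃ ∷ []) , _∷_ (_∷_ (_∷_ (_∷_ [])))
                   , cong +_ (trans k≡ (sym (lincomb-A j x₁ x₂ x₃)))

  frobenius-at : ∀ S T → 1 ≤ S → T < a → SizeLowerBound S T → (∀ t → t < a → Reaches S T t) →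
                 IsFrobeniusNumber A (+ (cost S T ∸ a))
  frobenius-at S T 1≤S T<a bound reaches = frobenius-criterion A (cost S T ∸ a)
    (λ xs len eq → not-representable S T T<a bound xs len
                     (trans (cong (_+ a) eq) (m∸n+n≡m (a≤cost S T 1≤S))))
    (λ k g<k → representable-above S T reaches k
                 (subst (_< k + a) (m∸n+n≡m (a≤cost S T 1≤S)) (+-monoˡ-< a g<k)))

  reaches₀ : ∀ S T q ρ → cost (ρ + q) (ρ + q * M) ≤ cost S T → Reaches S T (ρ + q * M)
  reaches₀ S T q ρ ≤cost = ρ , 0 , q , shape ρ q c
                          , subst (λ s → cost s (ρ + q * M) ≤ cost S T) (cong (_+ q) (sym (+-identityʳ ρ))) ≤cost
    where
    shape : ∀ ρ q c → ρ + (3 + c) * 0 + (5 + 2 * c) * q ≡ ρ + q * (5 + 2 * c)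
    shape = solve-∀

  reaches₁ : ∀ S T q e → cost (e + suc q) (b + e + q * M) ≤ cost S T → Reaches S T (b + e + q * M)
  reaches₁ S T q e ≤cost = e , 1 , q , shape e q c
                          , subst (λ s → cost s (b + e + q * M) ≤ cost S T) (sym (+-assoc e 1 q)) ≤cost
    where
    shape : ∀ e q c → e + (3 + c) * 1 + (5 + 2 * c) * q ≡ 3 + c + e + q * (5 + 2 * c)
    shape = solve-∀

  cost-exchange : suc c * d ≤ h * a → ∀ {s S t T} i j → s + j ≡ S → t ≡ T + i → i ≤ suc c → 1 ≤ j →
                  cost s t ≤ cost S T
  cost-exchange K {s} {S} {t} {T} i j refl refl i≤ 1≤j = begin
    cost s (T + i)         ≡⟨ split-weight s h a T i d ⟩
    cost s T + i * d       ≤⟨ +-monoʳ-≤ (cost s T) id≤jha ⟩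
    cost s T + j * (h * a) ≡⟨ merge-size s h a T j d ⟩
    cost (s + j) T         ∎
    where
    open ≤-Reasoning
    split-weight : ∀ s h a T i d → s * h * a + (T + i) * d ≡ s * h * a + T * d + i * d
    split-weight = solve-∀
    merge-size : ∀ s h a T j d → s * h * a + T * d + j * (h * a) ≡ (s + j) * h * a + T * d
    merge-size = solve-∀
    id≤jha : i * d ≤ j * (h * a)
    id≤jha = ≤-trans (*-monoˡ-≤ d i≤)
                     (≤-trans K (subst (_≤ j * (h * a)) (*-identityˡ (h * a)) (*-monoˡ-≤ (h * a) 1≤j)))

  reaches-below : ∀ S T Q → Q + suc c ≤ S → Q * M ≤ suc T →
                  ∀ q ρ → suc q ≤ Q → ρ < M → Reaches S T (ρ + q * M)
  reaches-below S T Q Q+c<S QM≤T q ρ q<Q ρ<M = by-digit (ρ ≤? 2 + c)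
    where
    open ≤-Reasoning
    size≤ : ∀ x → x ≤ 2 + c → x + q ≤ S
    size≤ x x≤ = begin
      x + q         ≤⟨ +-monoˡ-≤ q x≤ ⟩
      2 + c + q     ≡⟨ cong suc (trans (cong suc (+-comm c q)) (sym (+-suc q c))) ⟩
      suc q + suc c ≤⟨ +-monoˡ-≤ (suc c) q<Q ⟩
      Q + suc c     ≤⟨ Q+c<S ⟩
      S             ∎
    weight≤ : ∀ x → x < M → x + q * M ≤ T
    weight≤ x x<M = ≤-pred (begin
      suc x + q * M ≤⟨ +-monoˡ-≤ (q * M) x<M ⟩
      suc q * M     ≤⟨ *-monoˡ-≤ M q<Q ⟩
      Q * M         ≤⟨ QM≤T ⟩
      suc T         ∎)
    M≡b+[b∸1] : ∀ c → 5 + 2 * c ≡ 3 + c + (2 + c)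
    M≡b+[b∸1] = solve-∀
    by-digit : Dec (ρ ≤ 2 + c) → Reaches S T (ρ + q * M)
    by-digit (yes ρ≤) = reaches₀ S T q ρ (cost-mono (size≤ ρ ρ≤) (weight≤ ρ ρ<M))
    by-digit (no ρ≰) with m≤n⇒∃[o]m+o≡n (≰⇒> ρ≰)
    ... | e , refl = reaches₁ S T q e (cost-mono (subst (_≤ S) (sym (+-suc e q)) (size≤ (suc e) e<))
                                                 (weight≤ (b + e) ρ<M))
      where
      e< : suc e ≤ 2 + c
      e< = +-cancelˡ-≤ b (suc e) (2 + c) (subst₂ _≤_ (sym (+-suc b e)) (M≡b+[b∸1] c) ρ<M)

  reaches-all : ∀ S T Q r → a ≡ r + Q * M → r < M → Q + suc c ≤ S → Q * M ≤ suc T →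
                (∀ ρ → ρ < r → Reaches S T (ρ + Q * M)) → ∀ t → t < a → Reaches S T t
  reaches-all S T Q r a≡ r<M Q+c<S QM≤T top t t<a = subst (Reaches S T) (sym t≡) (by-row (<-cmp q Q))
    where
    ρ = t % M
    q = t / M
    t≡ : t ≡ ρ + q * M
    t≡ = m≡m%n+[m/n]*n t M
    by-row : Tri (q < Q) (q ≡ Q) (Q < q) → Reaches S T (ρ + q * M)
    by-row (tri< q<Q _ _) = reaches-below S T Q Q+c<S QM≤T q ρ q<Q (m%n<n t M)
    by-row (tri≈ _ refl _) = top ρ (+-cancelʳ-< (Q * M) ρ r (subst₂ _<_ t≡ a≡ t<a))
    by-row (tri> _ _ Q<q) = contradiction t<a (≤⇒≯ (begin
      a          ≡⟨ a≡ ⟩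
      r + Q * M  ≤⟨ +-monoˡ-≤ (Q * M) (<⇒≤ r<M) ⟩
      M + Q * M  ≤⟨ *-monoˡ-≤ M Q<q ⟩
      q * M      ≤⟨ m≤n+m (q * M) ρ ⟩
      ρ + q * M  ≡⟨ sym t≡ ⟩
      t          ∎))
      where open ≤-Reasoning

-- Q = a / M and r = a % M; writing Q = (b − 2) + w records the bound Q ≥ b − 2.
module ThreeCases (n h d c w r : ℕ) (cop : Coprime (suc n) d) (h≥1 : 1 ≤ h)
                  (K : suc c * d ≤ h * suc n)
                  (a≡ : suc n ≡ r + (suc c + w) * (5 + 2 * c)) (r<M : r < 5 + 2 * c) where
  open FourGenerators n h d c cop h≥1

  Q : ℕ
  Q = suc c + w

  QM≤a : Q * M ≤ a
  QM≤a = subst (Q * M ≤_) (sym a≡) (m≤n+m (Q * M) r)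

  frobenius-case : ∀ S T U → 1 ≤ S → T < a → T ≡ S + (2 + c) * U → 2 * T < M * suc U → M * S < T + a + M →
                   Q + suc c ≤ S → Q * M ≤ suc T → (∀ ρ → ρ < r → Reaches S T (ρ + Q * M)) →
                   IsFrobeniusNumber A (+ (cost S T ∸ a))
  frobenius-case S T U 1≤S T<a T≡ 2T< MS< Q+c≤S QM≤T top =
    frobenius-at S T 1≤S T<a (size-lower-bound S T U T≡ 2T< MS<) (reaches-all S T Q r a≡ r<M Q+c≤S QM≤T top)

  module Case₁ (r≤b∸2 : r ≤ suc c) where
    S T U : ℕ
    S = Q + suc c
    T = 4 + 2 * c + (c + w) * M
    U = 1 + 2 * (c + w)

    1+T≡QM : suc T ≡ Q * M
    1+T≡QM = identity c w
      where
      identity : ∀ c w → suc (4 + 2 * c + (c + w) * (5 + 2 * c)) ≡ (suc c + w) * (5 + 2 * c)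
      identity = solve-∀

    T≡S+[b∸1]U : T ≡ S + (2 + c) * U
    T≡S+[b∸1]U = identity c w
      where
      identity : ∀ c w → 4 + 2 * c + (c + w) * (5 + 2 * c) ≡ suc c + w + suc c + (2 + c) * (1 + 2 * (c + w))
      identity = solve-∀

    2T<M[1+U] : 2 * T < M * suc U
    2T<M[1+U] = m+n≤o⇒m≤o _ (≤-reflexive (identity c w))
      where
      identity : ∀ c w → suc (2 * (4 + 2 * c + (c + w) * (5 + 2 * c))) + 1 ≡ (5 + 2 * c) * suc (1 + 2 * (c + w))
      identity = solve-∀

    MS<T+a+M : M * S < T + a + M
    MS<T+a+M = ≤-trans (m+n≤o⇒m≤o _ (≤-reflexive (identity c w))) (+-monoˡ-≤ M (+-monoʳ-≤ T QM≤a))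
      where
      identity : ∀ c w → suc ((5 + 2 * c) * (suc c + w + suc c)) + (3 + 2 * c + w * (5 + 2 * c))
                         ≡ 4 + 2 * c + (c + w) * (5 + 2 * c) + (suc c + w) * (5 + 2 * c) + (5 + 2 * c)
      identity = solve-∀

    top-row : ∀ ρ → ρ < r → Reaches S T (ρ + Q * M)
    top-row ρ ρ<r with m≤n⇒∃[o]m+o≡n (≤-pred (≤-trans ρ<r r≤b∸2))
    ... | f , ρ+f≡c = reaches₀ S T Q ρ
          (cost-exchange K (suc ρ) (suc f) (trans (size≡ ρ f Q) (cong (λ x → Q + suc x) ρ+f≡c)) (weight≡ ρ c w)
                         (≤-trans ρ<r r≤b∸2) (s≤s z≤n))
      where
      size≡ : ∀ ρ f Q → ρ + Q + suc f ≡ Q + suc (ρ + f)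
      size≡ = solve-∀
      weight≡ : ∀ ρ c w → ρ + (suc c + w) * (5 + 2 * c) ≡ 4 + 2 * c + (c + w) * (5 + 2 * c) + suc ρ
      weight≡ = solve-∀

    P : ℕ
    P = (Q + suc c) * h * a + M * d * Q

    g+a+d≡P : cost S T ∸ a + a + d ≡ P
    g+a+d≡P = trans (cong (_+ d) (m∸n+n≡m (a≤cost S T (s≤s z≤n)))) (identity c w h a d)
      where
      identity : ∀ c w h a d → (suc c + w + suc c) * h * a + (4 + 2 * c + (c + w) * (5 + 2 * c)) * d + d
                               ≡ (suc c + w + suc c) * h * a + (5 + 2 * c) * d * (suc c + w)
      identity = solve-∀

    frobenius : IsFrobeniusNumber A (+ P ℤ.- + a ℤ.- + d)
    frobenius = subst (IsFrobeniusNumber A) (sym (+p-a-d≡+g (cost S T ∸ a) a d P g+a+d≡P))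
      (frobenius-case S T U (s≤s z≤n) (≤-trans (≤-reflexive 1+T≡QM) QM≤a) T≡S+[b∸1]U 2T<M[1+U] MS<T+a+M
                      ≤-refl (≤-reflexive (sym 1+T≡QM)) top-row)

  module Case₂ (r≡b∸1 : r ≡ 2 + c) where
    S T U : ℕ
    S = Q + suc c
    T = Q * M + suc c
    U = 2 * Q

    T<a : T < a
    T<a = begin
      suc T           ≡⟨ sym (+-suc (Q * M) (suc c)) ⟩
      Q * M + (2 + c) ≡⟨ +-comm (Q * M) (2 + c) ⟩
      (2 + c) + Q * M ≡⟨ cong (_+ Q * M) (sym r≡b∸1) ⟩
      r + Q * M       ≡⟨ sym a≡ ⟩
      a               ∎
      where open ≤-Reasoning

    T≡S+[b∸1]U : T ≡ S + (2 + c) * U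
    T≡S+[b∸1]U = identity c w
      where
      identity : ∀ c w → (suc c + w) * (5 + 2 * c) + suc c ≡ suc c + w + suc c + (2 + c) * (2 * (suc c + w))
      identity = solve-∀

    2T<M[1+U] : 2 * T < M * suc U
    2T<M[1+U] = m+n≤o⇒m≤o _ (≤-reflexive (identity c w))
      where
      identity : ∀ c w → suc (2 * ((suc c + w) * (5 + 2 * c) + suc c)) + 2 ≡ (5 + 2 * c) * suc (2 * (suc c + w))
      identity = solve-∀

    MS<T+a+M : M * S < T + a + M
    MS<T+a+M = ≤-trans (m+n≤o⇒m≤o _ (≤-reflexive (identity c w))) (+-monoˡ-≤ M (+-monoʳ-≤ T QM≤a))
      where
      identity : ∀ c w → suc ((5 + 2 * c) * (suc c + w + suc c)) + (5 + 2 * c + w * (5 + 2 * c) + c)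
                         ≡ (suc c + w) * (5 + 2 * c) + suc c + (suc c + w) * (5 + 2 * c) + (5 + 2 * c)
      identity = solve-∀

    top-row : ∀ ρ → ρ < r → Reaches S T (ρ + Q * M)
    top-row ρ ρ<r = reaches₀ S T Q ρ (cost-mono (subst (ρ + Q ≤_) (+-comm (suc c) Q) (+-monoˡ-≤ Q ρ≤))
                                               (subst (ρ + Q * M ≤_) (+-comm (suc c) (Q * M)) (+-monoˡ-≤ (Q * M) ρ≤)))
      where
      ρ≤ : ρ ≤ suc c
      ρ≤ = ≤-pred (subst (ρ <_) r≡b∸1 ρ<r)

    P : ℕ
    P = (Q + suc c) * h * a + M * d * Q

    g+a≡P+[b∸2]d : cost S T ∸ a + a ≡ P + suc c * d
    g+a≡P+[b∸2]d = trans (m∸n+n≡m (a≤cost S T (s≤s z≤n))) (identity c w h a d)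
      where
      identity : ∀ c w h a d → (suc c + w + suc c) * h * a + ((suc c + w) * (5 + 2 * c) + suc c) * d
                               ≡ (suc c + w + suc c) * h * a + (5 + 2 * c) * d * (suc c + w) + suc c * d
      identity = solve-∀

    frobenius : IsFrobeniusNumber A (+ P ℤ.- + a ℤ.+ + (suc c * d))
    frobenius = subst (IsFrobeniusNumber A) (sym (+p-a+x≡+g (cost S T ∸ a) a P (suc c * d) g+a≡P+[b∸2]d))
      (frobenius-case S T U (s≤s z≤n) T<a T≡S+[b∸1]U 2T<M[1+U] MS<T+a+M
                      ≤-refl (m≤n⇒m≤1+n (m≤m+n (Q * M) (suc c))) top-row)

  module Case₃ (b≤r : 3 + c ≤ r) where
    S T U : ℕ
    S = Q + (2 + c)
    T = Q * M + (2 + c)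
    U = 2 * Q

    T<a : T < a
    T<a = begin
      suc T           ≡⟨ sym (+-suc (Q * M) (2 + c)) ⟩
      Q * M + (3 + c) ≤⟨ +-monoʳ-≤ (Q * M) b≤r ⟩
      Q * M + r       ≡⟨ +-comm (Q * M) r ⟩
      r + Q * M       ≡⟨ sym a≡ ⟩
      a               ∎
      where open ≤-Reasoning

    T≡S+[b∸1]U : T ≡ S + (2 + c) * U
    T≡S+[b∸1]U = identity c w
      where
      identity : ∀ c w → (suc c + w) * (5 + 2 * c) + (2 + c) ≡ suc c + w + (2 + c) + (2 + c) * (2 * (suc c + w))
      identity = solve-∀

    2T<M[1+U] : 2 * T < M * suc U
    2T<M[1+U] = ≤-reflexive (identity c w)
      where
      identity : ∀ c w → suc (2 * ((suc c + w) * (5 + 2 * c) + (2 + c))) ≡ (5 + 2 * c) * suc (2 * (suc c + w))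
      identity = solve-∀

    MS<T+a+M : M * S < T + a + M
    MS<T+a+M = ≤-trans (m+n≤o⇒m≤o _ (≤-reflexive (identity c w))) (+-monoˡ-≤ M (+-monoʳ-≤ T QM≤a))
      where
      identity : ∀ c w → suc ((5 + 2 * c) * (suc c + w + (2 + c))) + (w * (5 + 2 * c) + 1 + c)
                         ≡ (suc c + w) * (5 + 2 * c) + (2 + c) + (suc c + w) * (5 + 2 * c) + (5 + 2 * c)
      identity = solve-∀

    top-row-carry : ∀ e → b + e < r → Reaches S T (b + e + Q * M)
    top-row-carry e ρ<r with m≤n⇒∃[o]m+o≡n e≤c
      where
      M≡ : ∀ c → 5 + 2 * c ≡ 5 + c + c
      M≡ = solve-∀
      e≤c : e ≤ c
      e≤c = +-cancelˡ-≤ (5 + c) e c (subst (5 + c + e ≤_) (M≡ c) (≤-trans (s≤s ρ<r) r<M))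
    ... | f , e+f≡c = reaches₁ S T Q e
          (cost-exchange K (suc e) (suc f) (trans (size≡ e f Q) (cong (λ x → Q + suc (suc x)) e+f≡c)) (weight≡ e c w)
                         (s≤s (m+n≤o⇒m≤o e (≤-reflexive e+f≡c))) (s≤s z≤n))
      where
      size≡ : ∀ e f Q → e + suc Q + suc f ≡ Q + suc (suc (e + f))
      size≡ = solve-∀
      weight≡ : ∀ e c w → 3 + c + e + (suc c + w) * (5 + 2 * c) ≡ (suc c + w) * (5 + 2 * c) + (2 + c) + suc e
      weight≡ = solve-∀

    top-row : ∀ ρ → ρ < r → Reaches S T (ρ + Q * M)
    top-row ρ ρ<r with ρ ≤? 2 + c
    ... | yes ρ≤ = reaches₀ S T Q ρ (cost-mono (subst (ρ + Q ≤_) (+-comm (2 + c) Q) (+-monoˡ-≤ Q ρ≤))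
                                               (subst (ρ + Q * M ≤_) (+-comm (2 + c) (Q * M)) (+-monoˡ-≤ (Q * M) ρ≤)))
    ... | no ρ≰ with m≤n⇒∃[o]m+o≡n (≰⇒> ρ≰)
    ...   | e , refl = top-row-carry e ρ<r

    P : ℕ
    P = (Q + (2 + c)) * h * a + M * d * Q

    g+a≡P+[b∸1]d : cost S T ∸ a + a ≡ P + (2 + c) * d
    g+a≡P+[b∸1]d = trans (m∸n+n≡m (a≤cost S T (s≤s z≤n))) (identity c w h a d)
      where
      identity : ∀ c w h a d → (suc c + w + (2 + c)) * h * a + ((suc c + w) * (5 + 2 * c) + (2 + c)) * d
                               ≡ (suc c + w + (2 + c)) * h * a + (5 + 2 * c) * d * (suc c + w) + (2 + c) * d
      identity = solve-∀

    frobenius : IsFrobeniusNumber A (+ P ℤ.- + a ℤ.+ + ((2 + c) * d))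
    frobenius = subst (IsFrobeniusNumber A) (sym (+p-a+x≡+g (cost S T ∸ a) a P ((2 + c) * d) g+a≡P+[b∸1]d))
      (frobenius-case S T U (s≤s z≤n) T<a T≡S+[b∸1]U 2T<M[1+U] MS<T+a+M
                      (+-monoʳ-≤ Q (n≤1+n (suc c))) (m≤n⇒m≤1+n (m≤m+n (Q * M) (2 + c))) top-row)

FrobeniusFormula : ℕ → ℕ → ℕ → ℕ → ℕ → ℕ → ℕ → Set
FrobeniusFormula a h d b m Q r =
     (r ≤ b ∸ 2 → IsFrobeniusNumber A (+ ((Q + b ∸ 2) * h * a + m * d * Q) ℤ.- + a ℤ.- + d))
   × (r ≡ b ∸ 1 → IsFrobeniusNumber A (+ ((Q + b ∸ 2) * h * a + m * d * Q) ℤ.- + a ℤ.+ + ((b ∸ 2) * d)))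
   × (b ≤ r → IsFrobeniusNumber A (+ ((Q + b ∸ 1) * h * a + m * d * Q) ℤ.- + a ℤ.+ + ((b ∸ 1) * d)))
  where
  A : List ℕ
  A = a ∷ (h * a + d) ∷ (h * a + b * d) ∷ (h * a + m * d) ∷ []

frobenius-formula : ∀ n h d c w r → Coprime (suc n) d → 1 ≤ h → suc c * d ≤ h * suc n →
                    suc n ≡ r + (suc c + w) * (5 + 2 * c) → r < 5 + 2 * c →
                    FrobeniusFormula (suc n) h d (3 + c) (5 + 2 * c) (suc c + w) r
frobenius-formula n h d c w r cop h≥1 K a≡ r<M =
    (λ r≤ → subst (λ S → IsFrobeniusNumber A (+ (S * h * a + M * d * Q) ℤ.- + a ℤ.- + d))
                  (sym (Q+b∸2 Q)) (Case₁.frobenius r≤))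
  , (λ r≡ → subst (λ S → IsFrobeniusNumber A (+ (S * h * a + M * d * Q) ℤ.- + a ℤ.+ + (suc c * d)))
                  (sym (Q+b∸2 Q)) (Case₂.frobenius r≡))
  , (λ b≤ → subst (λ S → IsFrobeniusNumber A (+ (S * h * a + M * d * Q) ℤ.- + a ℤ.+ + ((2 + c) * d)))
                  (sym (Q+b∸1 Q)) (Case₃.frobenius b≤))
  where
  open ThreeCases n h d c w r cop h≥1 K a≡ r<M
  open FourGenerators n h d c cop h≥1 using (A; a; M)
  Q+b∸2 : ∀ Q → Q + (3 + c) ∸ 2 ≡ Q + suc c
  Q+b∸2 Q = cong (_∸ 2) (trans (+-suc Q (2 + c)) (cong suc (+-suc Q (suc c))))
  Q+b∸1 : ∀ Q → Q + (3 + c) ∸ 1 ≡ Q + (2 + c)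
  Q+b∸1 Q = cong (_∸ 1) (+-suc Q (2 + c))

≤-ceilDiv* : ∀ d k → d ≤ ceilDiv d (suc k) * suc k
≤-ceilDiv* d k = +-cancelʳ-≤ k d (q * suc k) (begin
  d + k                       ≡⟨ m≡m%n+[m/n]*n (d + k) (suc k) ⟩
  (d + k) % suc k + q * suc k ≤⟨ +-monoˡ-≤ (q * suc k) (≤-pred (m%n<n (d + k) (suc k))) ⟩
  k + q * suc k               ≡⟨ +-comm k (q * suc k) ⟩
  q * suc k + k               ∎)
  where
  open ≤-Reasoning
  q = ceilDiv d (suc k)

ceilDiv≤⇒*≤* : ∀ {d k h a} → ceilDiv d (suc k) ≤ h → suc k * suc k ≤ a → suc k * d ≤ h * a
ceilDiv≤⇒*≤* {d} {k} {h} {a} ceil≤h k²≤a = begin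
  suc k * d             ≤⟨ *-monoʳ-≤ (suc k) (≤-trans (≤-ceilDiv* d k) (*-monoˡ-≤ (suc k) ceil≤h)) ⟩
  suc k * (h * suc k)   ≡⟨ regroup (suc k) h ⟩
  h * (suc k * suc k)   ≤⟨ *-monoʳ-≤ h k²≤a ⟩
  h * a                 ∎
  where
  open ≤-Reasoning
  regroup : ∀ s h → s * (h * s) ≡ h * (s * s)
  regroup = solve-∀

-- 2b² − 5b + 2 = (b − 2)(2b − 1).
[b∸2]*[2b∸1]≤a : ∀ a c → 2 * (3 + c) * (3 + c) + 2 ≤ a + 5 * (3 + c) → suc c * (5 + 2 * c) ≤ a
[b∸2]*[2b∸1]≤a a c big = +-cancelʳ-≤ (5 * (3 + c)) _ a (subst (_≤ a + 5 * (3 + c)) (sym (identity c)) big)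
  where
  identity : ∀ c → suc c * (5 + 2 * c) + 5 * (3 + c) ≡ 2 * (3 + c) * (3 + c) + 2
  identity = solve-∀

frobenius-formula-divmod : ∀ n h d c → Coprime (suc n) d → 1 ≤ h → ceilDiv d (suc c) ≤ h →
                           2 * (3 + c) * (3 + c) + 2 ≤ suc n + 5 * (3 + c) →
                           let M = 5 + 2 * c in FrobeniusFormula (suc n) h d (3 + c) M (suc n / M) (suc n % M)
frobenius-formula-divmod n h d c cop h≥1 ceil big with m≤n⇒∃[o]m+o≡n b∸2≤Q
  where
  M = 5 + 2 * c
  b∸2≤Q : suc c ≤ suc n / M
  b∸2≤Q = subst (_≤ suc n / M) (m*n/n≡m (suc c) M) (/-monoˡ-≤ M ([b∸2]*[2b∸1]≤a (suc n) c big))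
... | w , c+w≡Q = subst (λ Q → FrobeniusFormula a h d (3 + c) M Q (a % M)) c+w≡Q
                    (frobenius-formula n h d c w (a % M) cop h≥1 K a≡ (m%n<n a M))
  where
  a = suc n
  M = 5 + 2 * c
  b∸2≤M : suc c ≤ M
  b∸2≤M = m+n≤o⇒m≤o (suc c) (≤-reflexive (identity c))
    where
    identity : ∀ c → suc c + (4 + c) ≡ 5 + 2 * c
    identity = solve-∀
  K : suc c * d ≤ h * a
  K = ceilDiv≤⇒*≤* {d} {c} ceil (≤-trans (*-monoʳ-≤ (suc c) b∸2≤M) ([b∸2]*[2b∸1]≤a a c big))
  a≡ : a ≡ a % M + (suc c + w) * M
  a≡ = trans (m≡m%n+[m/n]*n a M) (cong (λ Q → a % M + Q * M) (sym c+w≡Q))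

theorem4p7 : (a h d b : ℕ) → 0 < a → 0 < h → 0 < d → 3 ≤ b → gcd a d ≡ 1 →
    ceilDiv d (b ∸ 2) ≤ h →
    2 * b * b + 2 ≤ a + 5 * b →
    let m = 2 * b ∸ 1
        Q = div a m
        r = mod a m
        A = a ∷ (h * a + d) ∷ (h * a + b * d) ∷ (h * a + m * d) ∷ []
    in (r ≤ b ∸ 2 →
          IsFrobeniusNumber A (+ ((Q + b ∸ 2) * h * a + m * d * Q) ℤ.- + a ℤ.- + d))
     × (r ≡ b ∸ 1 →
          IsFrobeniusNumber A (+ ((Q + b ∸ 2) * h * a + m * d * Q) ℤ.- + a ℤ.+ + ((b ∸ 2) * d)))
     × (b ≤ r →
          IsFrobeniusNumber A (+ ((Q + b ∸ 1) * h * a + m * d * Q) ℤ.- + a ℤ.+ + ((b ∸ 1) * d)))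
theorem4p7 (suc n) h d (suc (suc (suc c))) (s≤s z≤n) h≥1 _ (s≤s (s≤s (s≤s z≤n))) gcd≡1 ceil big =
  subst (λ m → FrobeniusFormula (suc n) h d (3 + c) m (div (suc n) m) (mod (suc n) m)) (sym (2b∸1≡M c))
        (frobenius-formula-divmod n h d c (gcd≡1⇒coprime gcd≡1) h≥1 ceil big)
  where
  2b∸1≡M : ∀ c → 2 * (3 + c) ∸ 1 ≡ 5 + 2 * c
  2b∸1≡M c = cong (_∸ 1) (identity c)
    where
    identity : ∀ c → 2 * (3 + c) ≡ 1 + (5 + 2 * c)
    identity = solve-∀
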